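{- Assume the set $\mathcal P$ of atoms is finite, and let $n\in\mathbb N$. For all in-models $M,M'$: (1) if $w,w'$ are worlds of $M,M'$ respectively and $M,w\equiv_n M',w'$, then $M,w\sim_n M',w'$; (2) if $s,s'$ are information states of $M,M'$ respectively and $M,s\equiv_n M',s'$, then $M,s\sim_n M',s'$.
   Context: Fix a set $\mathcal P$ of atoms. Formulas of $\mathcal L_{\Rrightarrow}$ are given by $\varphi ::= p \mid \bot \mid (\varphi\wedge\varphi)\mid(\varphi\to\varphi)\mid(\varphi\veebar\varphi)\mid(\varphi\Rrightarrow\varphi)$ with $p\in\mathcal P$, where $\veebar$ denotes inquisitive disjunction. Modal depth: $\mathrm{md}(p)=\mathrm{md}(\bot)=0$; $\mathrm{md}(\varphi\circ\psi)=\max(\mathrm{md}(\varphi),\mathrm{md}(\psi))$ for $\circ\in\{\wedge,\veebar,\to\}$; $\mathrm{md}(\varphi\Rrightarrow\psi)=\max(\mathrm{md}(\varphi),\mathrm{md}(\psi))+1$. An in-model is $M=\langle W,\Sigma,V\rangle$ where $W$ is a nonempty set, $\Sigma$ assigns to each $w\in W$ a set $\Sigma(w)$ of nonempty subsets of $W$, and $V:W\times\mathcal P\to\{0,1\}$. Support at $s\subseteq W$: $M,s\models p$ iff $V(w,p)=1$ for all $w\in s$; $M,s\models\bot$ iff $s=\emptyset$; $M,s\models\varphi\wedge\psi$ iff both; $M,s\models\varphi\veebar\psi$ iff $M,s\models\varphi$ or $M,s\models\psi$; $M,s\models\varphi\to\psi$ iff for all $t\subseteq s$, $M,t\models\varphi$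 implies $M,t\models\psi$; $M,s\models\varphi\Rrightarrow\psi$ iff for all $w\in s$ and $t\in\Sigma(w)$, $M,t\models\varphi$ implies $M,t\models\psi$. Truth: $M,w\models\varphi$ iff $M,\{w\}\models\varphi$. $M,w\equiv_n M',w'$ means $w$ and $w'$ make true the same formulas of modal depth at most $n$; $M,s\equiv_n M',s'$ means $s$ and $s'$ support the same formulas of modal depth at most $n$. Egli-Milner lifting of $R\subseteq X\times Y$: $A\overline R B$ iff every $a\in A$ has $b\in B$ with $aRb$ and every $b\in B$ has $a\in A$ with $aRb$. An $n$-bisimulation between $M=\langle W,\Sigma,V\rangle$ and $M'=\langle W',\Sigma',V'\rangle$ is a family $(Z_i)_{i\le n}$, $Z_i\subseteq W\times W'$, such that whenever $wZ_iw'$: $V(w,p)=V'(w',p)$ for all $p$; if $i>0$, every $s\in\Sigma(w)$ has some $s'\in\Sigma'(w')$ with $s\overline{Z_{i-1}}s'$, and every $s'\in\Sigma'(w')$ has some $s\in\Sigma(w)$ with $s\overline{Z_{i-1}}s'$. $M,w\sim_nM',w'$ iff some $n$-bisimulation has $wZ_nw'$; $M,s\sim_nM',s'$ iff some $n$-bisimulation has $s\overline{Z_n}s'$. -}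

module Defs where

open import Level using (Level; Lift; 0ℓ) renaming (suc to lsuc)
open import Data.Nat using (ℕ; zero; suc; _⊔_; _≤_)
open import Data.Fin using (Fin)
open import Data.Bool using (Bool; true)
open import Data.Product using (Σ; ∃; _×_; _,_)
open import Data.Sum using (_⊎_)
open import Relation.Nullary using (¬_)
open import Relation.Binary.PropositionalEquality using (_≡_)
open import Function.Bundles using (_⇔_)

-- The finite set of atoms is Fin k.
infixr 6 _∧f_
infixr 5 _⩒_
infixr 4 _→f_ _⇛_

data Form (k : ℕ) : Set where
  atom : Fin k → Form k
  ⊥f   : Form k
  _∧f_ : Form k → Form k → Form k
  _→f_ : Form k → Form k → Form k
  _⩒_  : Form k → Form k → Form k
  _⇛_  : Form k → Form k → Form k

md : ∀ {k} → Form k → ℕ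
md (atom p) = 0
md ⊥f = 0
md (φ ∧f ψ) = md φ ⊔ md ψ
md (φ →f ψ) = md φ ⊔ md ψ
md (φ ⩒ ψ) = md φ ⊔ md ψ
md (φ ⇛ ψ) = suc (md φ ⊔ md ψ)

Subset : Set → Set₁
Subset W = W → Set

_⊆_ : ∀ {W : Set} → Subset W → Subset W → Set
_⊆_ {W} t s = ∀ (w : W) → t w → s w

Nonempty : ∀ {W : Set} → Subset W → Set
Nonempty {W} s = Σ W s

singleton : ∀ {W : Set} → W → Subset W
singleton w = λ x → x ≡ w

record InModel (k : ℕ) : Set₂ where
  field
    W      : Set
    world  : W                              -- W is nonempty
    Sig    : W → Subset W → Set₁            -- s ∈ Σ(w)
    Sig-ne : ∀ w s → Sig w s → Nonempty s
    V      : W → Fin k → Bool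

module _ {k : ℕ} (M : InModel k) where
  open InModel M

  supp : Subset W → Form k → Set₁
  supp s (atom p) = Lift _ (∀ w → s w → V w p ≡ true)
  supp s ⊥f       = Lift _ (∀ w → ¬ s w)
  supp s (φ ∧f ψ) = supp s φ × supp s ψ
  supp s (φ ⩒ ψ)  = supp s φ ⊎ supp s ψ
  supp s (φ →f ψ) = ∀ (t : Subset W) → t ⊆ s → supp t φ → supp t ψ
  supp s (φ ⇛ ψ)  = ∀ w → s w → ∀ (t : Subset W) → Sig w t → supp t φ → supp t ψ

  true-at : W → Form k → Set₁
  true-at w φ = supp (singleton w) φ

StateEquiv : ∀ {k} (n : ℕ) (M M' : InModel k) →
             Subset (InModel.W M) → Subset (InModel.W M') → Set₁
StateEquiv n M M' s s' = ∀ φ → md φ ≤ n → (supp M s φ ⇔ supp M' s' φ)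

WorldEquiv : ∀ {k} (n : ℕ) (M M' : InModel k) → InModel.W M → InModel.W M' → Set₁
WorldEquiv n M M' w w' = ∀ φ → md φ ≤ n → (true-at M w φ ⇔ true-at M' w' φ)

EM : ∀ {X Y : Set} → (X → Y → Set₁) → Subset X → Subset Y → Set₁
EM {X} {Y} R A B = (∀ (a : X) → A a → Σ Y λ b → B b × R a b)
                 × (∀ (b : Y) → B b → Σ X λ a → A a × R a b)

-- n-bisimulations: a family Z i (only i ≤ n matters)
IsBisim : ∀ {k} (n : ℕ) (M M' : InModel k) →
          (ℕ → InModel.W M → InModel.W M' → Set₁) → Set₁
IsBisim n M M' Z =
  (∀ i w w' → i ≤ n → Z i w w' → ∀ p → InModel.V M w p ≡ InModel.V M' w' p)
  × (∀ i w w' → suc i ≤ n → Z (suc i) w w' →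
       (∀ s → InModel.Sig M w s →
          Σ (Subset (InModel.W M')) λ s' → InModel.Sig M' w' s' × EM (Z i) s s')
     × (∀ s' → InModel.Sig M' w' s' →
          Σ (Subset (InModel.W M)) λ s → InModel.Sig M w s × EM (Z i) s s'))

WorldBisim : ∀ {k} (n : ℕ) (M M' : InModel k) → InModel.W M → InModel.W M' → Set₂
WorldBisim n M M' w w' =
  Σ (ℕ → InModel.W M → InModel.W M' → Set₁) λ Z → IsBisim n M M' Z × Z n w w'

StateBisim : ∀ {k} (n : ℕ) (M M' : InModel k) →
             Subset (InModel.W M) → Subset (InModel.W M') → Set₂
StateBisim n M M' s s' =
  Σ (ℕ → InModel.W M → InModel.W M' → Set₁) λ Z → IsBisim n M M' Z × EM (Z n) s s'

{-# OPTIONS --safe #-}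

-- Call the truth-value vector of a world on a finite family of formulas basis i of
-- depth ≤ i its i-type. basis 0 are the atoms; basis (i+1) adds, for every set S of
-- i-types, a formula γ S that fails at w exactly when some t ∈ Σ(w) realizes
-- precisely the i-types in S. Hence "same i-type" is an n-bisimulation: if w, w'
-- have the same (i+1)-type and s ∈ Σ(w), then γ (i-types of s) fails at w, hence
-- at w', which yields s' ∈ Σ(w') realizing the same i-types as s, and such states
-- are Egli-Milner related. n-equivalent worlds have the same n-type, and
-- n-equivalent states realize the same n-types, since s realizes σ iff s does not
-- support ¬ χ σ. Excluded middle is needed to read truth values as Booleans.

module Submission where

open import Defs
open import Level using (0ℓ; Lift; lift; lower) renaming (suc to lsuc)
open import Axiom.ExcludedMiddle using (ExcludedMiddle)
open import Data.Nat using (ℕ; zero; suc; _+_; _^_; _≤_; z≤n; s≤s)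
open import Data.Nat.Properties using (⊔-lub)
open import Data.Bool using (Bool; true; false; if_then_else_)
open import Data.Bool.Properties using (⇔→≡)
open import Data.Fin using (Fin; zero; suc; splitAt; _↑ˡ_; _↑ʳ_)
open import Data.Fin.Properties using (2↔Bool; splitAt-↑ˡ; splitAt-↑ʳ)
open import Data.Vec using (Vec; lookup; tabulate)
open import Data.Vec.Properties using (lookup∘tabulate; tabulate-cong)
import Data.Vec.Recursive as Rec
open import Data.Vec.Recursive.Properties using (toVec∘fromVec; fromVec∘toVec)
open import Data.Vec.Relation.Binary.Pointwise.Extensional using (ext; Pointwise-≡⇒≡)
open import Data.Product using (Σ; _×_; _,_; proj₁; proj₂)
open import Data.Sum using (_⊎_; inj₁; inj₂; [_,_]′)
open import Data.Empty using (⊥-elim)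
open import Function using (_∘_; const; case_of_)
open import Function.Bundles using (_⇔_; _↔_; mk⇔; mk↔ₛ′; Inverse)
open import Function.Properties.Inverse using (↔-trans)
open import Function.Construct.Composition using () renaming (equivalence to ⇔-trans)
open import Function.Construct.Symmetry using (⇔-sym)
open import Function.Related.TypeIsomorphisms using (¬-cong-⇔)
open import Relation.Nullary using (¬_; Dec; yes; no; does)
open import Relation.Nullary.Decidable using (map′; decidable-stable; does-⇔)
open import Relation.Binary.PropositionalEquality
  using (_≡_; refl; sym; trans; cong; subst; module ≡-Reasoning)

open Function.Bundles.Equivalence using (to; from)

Fin[2^m]↔Vec-Bool : ∀ m → Fin (2 ^ m) ↔ Vec Bool m
Fin[2^m]↔Vec-Bool m =
  ↔-trans (Rec.Fin[m^n]↔Fin[m]^n 2 m)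
  (↔-trans (Rec.lift↔ m 2↔Bool)
           (mk↔ₛ′ (Rec.toVec m) Rec.fromVec toVec∘fromVec (fromVec∘toVec m)))

module _ {m : ℕ} where

  decode : Fin (2 ^ m) → Vec Bool m
  decode = Inverse.to (Fin[2^m]↔Vec-Bool m)

  encode : Vec Bool m → Fin (2 ^ m)
  encode = Inverse.from (Fin[2^m]↔Vec-Bool m)

  decode-encode : ∀ σ → decode (encode σ) ≡ σ
  decode-encode = Inverse.strictlyInverseˡ (Fin[2^m]↔Vec-Bool m)

  encode-decode : ∀ J → encode (decode J) ≡ J
  encode-decode = Inverse.strictlyInverseʳ (Fin[2^m]↔Vec-Bool m)

module _ {a} {A : Set a} where

  does≡true⇔ : (a? : Dec A) → does a? ≡ true ⇔ A
  does≡true⇔ (yes a) = mk⇔ (const a) (const refl)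
  does≡true⇔ (no ¬a) = mk⇔ (λ ()) (⊥-elim ∘ ¬a)

  does≡false⇔ : (a? : Dec A) → does a? ≡ false ⇔ (¬ A)
  does≡false⇔ (yes a) = mk⇔ (λ ()) (λ ¬a → ⊥-elim (¬a a))
  does≡false⇔ (no ¬a) = mk⇔ (const ¬a) (const refl)

  does-≡⇒⇔ : ∀ {b} {B : Set b} (a? : Dec A) (b? : Dec B) → does a? ≡ does b? → A ⇔ B
  does-≡⇒⇔ (yes a) (yes b) _  = mk⇔ (const b) (const a)
  does-≡⇒⇔ (no ¬a) (no ¬b) _  = mk⇔ (⊥-elim ∘ ¬a) (⊥-elim ∘ ¬b)
  does-≡⇒⇔ (yes _) (no _)  ()
  does-≡⇒⇔ (no _)  (yes _) ()

module _ {k : ℕ} where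

  infix 7 ¬f_

  ⊤f : Form k
  ⊤f = ⊥f →f ⊥f

  ¬f_ : Form k → Form k
  ¬f φ = φ →f ⊥f

  ⋀ : ∀ {m} → (Fin m → Form k) → Form k
  ⋀ {zero}  f = ⊤f
  ⋀ {suc m} f = f zero ∧f ⋀ (f ∘ suc)

  ⋁ : ∀ {m} → (Fin m → Form k) → Form k
  ⋁ {zero}  f = ⊥f
  ⋁ {suc m} f = f zero ⩒ ⋁ (f ∘ suc)

  md-¬f : ∀ φ {i} → md φ ≤ i → md (¬f φ) ≤ i
  md-¬f φ h = ⊔-lub h z≤n

  md-⋀ : ∀ {m i} (f : Fin m → Form k) → (∀ j → md (f j) ≤ i) → md (⋀ f) ≤ i
  md-⋀ {zero}  f h = z≤n
  md-⋀ {suc m} f h = ⊔-lub (h zero) (md-⋀ (f ∘ suc) (h ∘ suc))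

  md-⋁ : ∀ {m i} (f : Fin m → Form k) → (∀ j → md (f j) ≤ i) → md (⋁ f) ≤ i
  md-⋁ {zero}  f h = z≤n
  md-⋁ {suc m} f h = ⊔-lub (h zero) (md-⋁ (f ∘ suc) (h ∘ suc))

module Support {k : ℕ} (M : InModel k) where
  open InModel M

  persistent : ∀ φ {s t : Subset W} → t ⊆ s → supp M s φ → supp M t φ
  persistent (atom p) t⊆s (lift h)   = lift λ w tw → h w (t⊆s w tw)
  persistent ⊥f       t⊆s (lift h)   = lift λ w tw → h w (t⊆s w tw)
  persistent (φ ∧f ψ) t⊆s (sφ , sψ)  = persistent φ t⊆s sφ , persistent ψ t⊆s sψ
  persistent (φ →f ψ) t⊆s h u u⊆t    = h u λ w uw → t⊆s w (u⊆t w uw)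
  persistent (φ ⩒ ψ)  t⊆s (inj₁ sφ)  = inj₁ (persistent φ t⊆s sφ)
  persistent (φ ⩒ ψ)  t⊆s (inj₂ sψ)  = inj₂ (persistent ψ t⊆s sψ)
  persistent (φ ⇛ ψ)  t⊆s h w tw     = h w (t⊆s w tw)

  supp⇒true-at : ∀ φ {s : Subset W} {v} → supp M s φ → s v → true-at M v φ
  supp⇒true-at φ sφ sv = persistent φ (λ { _ refl → sv }) sφ

  supp-¬f : ∀ φ {t : Subset W} → supp M t (¬f φ) ⇔ (∀ v → t v → ¬ true-at M v φ)
  supp-¬f φ = mk⇔
    (λ h v tv vφ → lower (h (singleton v) (λ { _ refl → tv }) vφ) v refl)
    (λ h u u⊆t uφ → lift λ v uv → h v (u⊆t v uv) (supp⇒true-at φ uφ uv))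

  true-at-¬f : ∀ φ {v} → true-at M v (¬f φ) ⇔ (¬ true-at M v φ)
  true-at-¬f φ = mk⇔ (λ h → to (supp-¬f φ) h _ refl)
                     (λ h → from (supp-¬f φ) λ { _ refl → h })

  true-at-atom : ∀ p {w} → true-at M w (atom p) ⇔ V w p ≡ true
  true-at-atom p = mk⇔ (λ h → lower h _ refl) (λ e → lift λ { _ refl → e })

  supp-⋀ : ∀ {m} (f : Fin m → Form k) {t : Subset W} →
           supp M t (⋀ f) ⇔ (∀ j → supp M t (f j))
  supp-⋀ {zero}  f = mk⇔ (λ _ ()) (λ _ _ _ u⊥ → u⊥)
  supp-⋀ {suc m} f = mk⇔
    (λ { (h₀ , _) zero → h₀ ; (_ , hs) (suc j) → to (supp-⋀ (f ∘ suc)) hs j })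
    (λ h → h zero , from (supp-⋀ (f ∘ suc)) (h ∘ suc))

  supp-⋁-intro : ∀ {m} (f : Fin m → Form k) {t : Subset W} j →
                 supp M t (f j) → supp M t (⋁ f)
  supp-⋁-intro f zero    h = inj₁ h
  supp-⋁-intro f (suc j) h = inj₂ (supp-⋁-intro (f ∘ suc) j h)

  supp-⋁-elim : ∀ {m} (f : Fin m → Form k) {t : Subset W} → Nonempty t →
                supp M t (⋁ f) → Σ (Fin m) λ j → supp M t (f j)
  supp-⋁-elim {zero}  f (w , tw) (lift h) = ⊥-elim (h w tw)
  supp-⋁-elim {suc m} f ne (inj₁ h) = zero , h
  supp-⋁-elim {suc m} f ne (inj₂ h) with supp-⋁-elim (f ∘ suc) ne h
  ... | j , hj = suc j , hj

  ⇛-counterexample : ExcludedMiddle (lsuc 0ℓ) → ∀ φ ψ {w} → ¬ true-at M w (φ ⇛ ψ) →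
                     Σ (Subset W) λ t → Sig w t × supp M t φ × ¬ supp M t ψ
  ⇛-counterexample lem φ ψ ¬w⊨ = decidable-stable lem λ none →
    ¬w⊨ λ { _ refl t wΣt tφ → decidable-stable lem λ ¬tψ → none (t , wΣt , tφ , ¬tψ) }

-- A type over β is a vector of truth values for β; a set S of types is given by
-- its characteristic vector over the codes of types, so σ ∈ S is read off at encode σ.
module Characteristic {k m : ℕ} (β : Fin m → Form k) where

  literal : Bool → Form k → Form k
  literal true  φ = φ
  literal false φ = ¬f φ

  χ : Vec Bool m → Form k
  χ σ = ⋀ λ j → literal (lookup σ j) (β j)

  _∈ᵗ_ : Vec Bool m → Vec Bool (2 ^ m) → Set
  σ ∈ᵗ S = lookup S (encode σ) ≡ true

  δ-conjunct : Vec Bool (2 ^ m) → Fin (2 ^ m) → Form k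
  δ-conjunct S J = if lookup S J then ⊤f else ¬f χ (decode J)

  D-disjunct : Vec Bool (2 ^ m) → Fin (2 ^ m) → Form k
  D-disjunct S J = if lookup S J then ¬f χ (decode J) else ⊥f

  δ : Vec Bool (2 ^ m) → Form k
  δ S = ⋀ (δ-conjunct S)

  D : Vec Bool (2 ^ m) → Form k
  D S = ⋁ (D-disjunct S)

  γ : Vec Bool (2 ^ m) → Form k
  γ S = δ S ⇛ D S

  module _ {i : ℕ} (md-β : ∀ j → md (β j) ≤ i) where

    md-χ : ∀ σ → md (χ σ) ≤ i
    md-χ σ = md-⋀ _ λ j → md-literal (lookup σ j) (β j) (md-β j)
      where
      md-literal : ∀ b φ → md φ ≤ i → md (literal b φ) ≤ i
      md-literal true  φ h = h
      md-literal false φ h = md-¬f φ h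

    md-γ : ∀ S → md (γ S) ≤ suc i
    md-γ S = s≤s (⊔-lub (md-⋀ (δ-conjunct S) md-δ-conjunct)
                        (md-⋁ (D-disjunct S) md-D-disjunct))
      where
      md-δ-conjunct : ∀ J → md (δ-conjunct S J) ≤ i
      md-δ-conjunct J with lookup S J
      ... | true  = z≤n
      ... | false = md-¬f (χ (decode J)) (md-χ (decode J))

      md-D-disjunct : ∀ J → md (D-disjunct S J) ≤ i
      md-D-disjunct J with lookup S J
      ... | true  = md-¬f (χ (decode J)) (md-χ (decode J))
      ... | false = z≤n

module Types (lem : ExcludedMiddle (lsuc 0ℓ)) {k : ℕ} (M : InModel k)
             {m : ℕ} (β : Fin m → Form k) where
  open InModel M
  open Support M
  open Characteristic β

  lem₀ : ExcludedMiddle 0ℓ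
  lem₀ = map′ lower lift lem

  type : W → Vec Bool m
  type v = tabulate λ j → does (lem {true-at M v (β j)})

  lookup-type : ∀ v j → lookup (type v) j ≡ does (lem {true-at M v (β j)})
  lookup-type v j = lookup∘tabulate _ j

  true-at-literal : ∀ b φ {v} → true-at M v (literal b φ) ⇔ does (lem {true-at M v φ}) ≡ b
  true-at-literal true  φ = ⇔-sym (does≡true⇔ lem)
  true-at-literal false φ = ⇔-trans (true-at-¬f φ) (⇔-sym (does≡false⇔ lem))

  true-at-χ : ∀ σ {v} → true-at M v (χ σ) ⇔ type v ≡ σ
  true-at-χ σ {v} = mk⇔
    (λ vχ → Pointwise-≡⇒≡ (ext λ j →
      trans (lookup-type v j) (to (true-at-literal (lookup σ j) (β j)) (to (supp-⋀ _) vχ j))))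
    (λ e → from (supp-⋀ _) λ j → from (true-at-literal (lookup σ j) (β j))
      (trans (sym (lookup-type v j)) (cong (λ τ → lookup τ j) e)))

  Realizes : Subset W → Vec Bool m → Set
  Realizes t σ = Σ W λ a → t a × type a ≡ σ

  supp-¬χ : ∀ σ {t} → supp M t (¬f χ σ) ⇔ (¬ Realizes t σ)
  supp-¬χ σ = mk⇔
    (λ h (a , ta , e) → to (supp-¬f (χ σ)) h a ta (from (true-at-χ σ) e))
    (λ h → from (supp-¬f (χ σ)) λ v tv vχ → h (v , tv , to (true-at-χ σ) vχ))

  Realizes⇔¬supp-¬χ : ∀ σ {t} → Realizes t σ ⇔ (¬ supp M t (¬f χ σ))
  Realizes⇔¬supp-¬χ σ = mk⇔
    (λ r h → to (supp-¬χ σ) h r)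
    (λ h → decidable-stable lem₀ λ ¬r → h (from (supp-¬χ σ) ¬r))

  typeSet : Subset W → Vec Bool (2 ^ m)
  typeSet t = tabulate λ J → does (lem₀ {Realizes t (decode J)})

  ∈-typeSet : ∀ σ {t} → σ ∈ᵗ typeSet t ⇔ Realizes t σ
  ∈-typeSet σ {t}
    rewrite lookup∘tabulate (λ J → does (lem₀ {Realizes t (decode J)})) (encode σ)
          | decode-encode σ
    = does≡true⇔ lem₀

  supp-δ : ∀ S {t} → supp M t (δ S) ⇔ (∀ σ → Realizes t σ → σ ∈ᵗ S)
  supp-δ S {t} = mk⇔
    (λ h σ r → to (conjunct (encode σ)) (to (supp-⋀ _) h (encode σ))
                  (subst (Realizes t) (sym (decode-encode σ)) r))
    (λ h → from (supp-⋀ _) λ J → from (conjunct J) λ r →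
      subst (λ J′ → lookup S J′ ≡ true) (encode-decode {m} J) (h (decode J) r))
    where
    conjunct : ∀ J → supp M t (δ-conjunct S J) ⇔ (Realizes t (decode J) → lookup S J ≡ true)
    conjunct J with lookup S J
    ... | true  = mk⇔ (λ _ _ → refl) (λ _ _ _ u⊥ → u⊥)
    ... | false = mk⇔ (λ h r → ⊥-elim (to (supp-¬χ _) h r))
                      (λ h → from (supp-¬χ _) λ r → case h r of λ ())

  supp-D : ∀ S {t} → Nonempty t →
           supp M t (D S) ⇔ Σ (Vec Bool m) λ σ → σ ∈ᵗ S × ¬ Realizes t σ
  supp-D S {t} ne = mk⇔
    (λ h → let (J , hJ) = supp-⋁-elim _ ne h ; (J∈S , ¬r) = to (disjunct J) hJ in
      decode J , subst (λ J′ → lookup S J′ ≡ true) (sym (encode-decode {m} J)) J∈S , ¬r)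
    (λ (σ , σ∈S , ¬r) → supp-⋁-intro _ (encode σ) (from (disjunct (encode σ))
      (σ∈S , subst (λ τ → ¬ Realizes t τ) (sym (decode-encode σ)) ¬r)))
    where
    disjunct : ∀ J → supp M t (D-disjunct S J) ⇔ (lookup S J ≡ true × ¬ Realizes t (decode J))
    disjunct J with lookup S J
    ... | true  = mk⇔ (λ h → refl , to (supp-¬χ _) h) (from (supp-¬χ _) ∘ proj₂)
    ... | false = mk⇔ (λ h → ⊥-elim (lower h (proj₁ ne) (proj₂ ne))) λ ()

  RealizesExactly : Subset W → Vec Bool (2 ^ m) → Set
  RealizesExactly t S = ∀ σ → Realizes t σ ⇔ σ ∈ᵗ S

  γ-typeSet-false : ∀ {w s} → Sig w s → ¬ true-at M w (γ (typeSet s))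
  γ-typeSet-false {w} {s} w⇛s wγ =
    let (σ , σ∈ , ¬r) = to (supp-D (typeSet s) (Sig-ne w s w⇛s))
                           (wγ w refl s w⇛s (from (supp-δ (typeSet s)) λ σ → from (∈-typeSet σ)))
    in ¬r (to (∈-typeSet σ) σ∈)

  γ-false⇒RealizesExactly : ∀ S {w} → ¬ true-at M w (γ S) →
                            Σ (Subset W) λ t → Sig w t × RealizesExactly t S
  γ-false⇒RealizesExactly S {w} ¬wγ =
    let (t , w⇛t , tδ , ¬tD) = ⇛-counterexample lem (δ S) (D S) ¬wγ in
    t , w⇛t , λ σ → mk⇔ (to (supp-δ S) tδ σ) λ σ∈ →
      decidable-stable lem₀ λ ¬r → ¬tD (from (supp-D S (Sig-ne w t w⇛t)) (σ , σ∈ , ¬r))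

module TwoModels (lem : ExcludedMiddle (lsuc 0ℓ)) {k : ℕ} (M M' : InModel k)
                 {m : ℕ} (β : Fin m → Form k) where
  open InModel M
  open InModel M' using () renaming (W to W'; Sig to Sig')
  open Characteristic β
  private
    module T  = Types lem M  β
    module T' = Types lem M' β

  SameType : W → W' → Set₁
  SameType a a' = Lift (lsuc 0ℓ) (T.type a ≡ T'.type a')

  agree⇒SameType : ∀ {a a'} → (∀ j → true-at M a (β j) ⇔ true-at M' a' (β j)) →
                   SameType a a'
  agree⇒SameType agree = lift (tabulate-cong λ j → does-⇔ (agree j) lem lem)

  SameType⇒agree : ∀ {a a'} → SameType a a' →
                   ∀ j → true-at M a (β j) ⇔ true-at M' a' (β j)
  SameType⇒agree {a} {a'} (lift e) j = does-≡⇒⇔ lem lem (begin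
    does lem                ≡⟨ T.lookup-type a j ⟨
    lookup (T.type a) j     ≡⟨ cong (λ τ → lookup τ j) e ⟩
    lookup (T'.type a') j   ≡⟨ T'.lookup-type a' j ⟩
    does lem                ∎)
    where open ≡-Reasoning

  EM-SameType : ∀ {s s'} → (∀ σ → T.Realizes s σ ⇔ T'.Realizes s' σ) → EM SameType s s'
  EM-SameType same =
      (λ a sa → let (a' , sa' , e) = to (same (T.type a)) (a , sa , refl)
                in a' , sa' , lift (sym e))
    , (λ a' sa' → let (a , sa , e) = from (same (T'.type a')) (a' , sa' , refl)
                  in a , sa , lift e)

  Realizes-transfer : ∀ {s s'} → (∀ σ → supp M s (¬f χ σ) ⇔ supp M' s' (¬f χ σ)) →
                      ∀ σ → T.Realizes s σ ⇔ T'.Realizes s' σ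
  Realizes-transfer same σ =
    ⇔-trans (T.Realizes⇔¬supp-¬χ σ)
            (⇔-trans (¬-cong-⇔ (same σ)) (⇔-sym (T'.Realizes⇔¬supp-¬χ σ)))

  zig : ∀ {w w'} → (∀ S → true-at M' w' (γ S) → true-at M w (γ S)) →
        ∀ {s} → Sig w s → Σ (Subset W') λ s' → Sig' w' s' × EM SameType s s'
  zig back {s} w⇛s =
    let (s' , w'⇛s' , exact) = T'.γ-false⇒RealizesExactly (T.typeSet s)
                                 (T.γ-typeSet-false w⇛s ∘ back (T.typeSet s))
    in s' , w'⇛s' , EM-SameType λ σ → ⇔-sym (⇔-trans (exact σ) (T.∈-typeSet σ))

  zag : ∀ {w w'} → (∀ S → true-at M w (γ S) → true-at M' w' (γ S)) →
        ∀ {s'} → Sig' w' s' → Σ (Subset W) λ s → Sig w s × EM SameType s s'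
  zag forth {s'} w'⇛s' =
    let (s , w⇛s , exact) = T.γ-false⇒RealizesExactly (T'.typeSet s')
                              (T'.γ-typeSet-false w'⇛s' ∘ forth (T'.typeSet s'))
    in s , w⇛s , EM-SameType λ σ → ⇔-trans (exact σ) (T'.∈-typeSet σ)

module Hierarchy (k : ℕ) where
  open Characteristic using (γ; md-γ)

  size : ℕ → ℕ
  size zero    = k
  size (suc i) = k + 2 ^ 2 ^ size i

  basis : ∀ i → Fin (size i) → Form k
  atoms-and-γ : ∀ i → Fin k ⊎ Fin (2 ^ 2 ^ size i) → Form k

  basis zero    = atom
  basis (suc i) = atoms-and-γ i ∘ splitAt k

  atoms-and-γ i = [ atom , γ (basis i) ∘ decode ]′

  md-basis : ∀ i j → md (basis i j) ≤ i
  md-basis zero    j = z≤n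
  md-basis (suc i) j with splitAt k j
  ... | inj₁ p = z≤n
  ... | inj₂ J = md-γ (basis i) (md-basis i) (decode J)

  _∈-basis_ : Form k → ℕ → Set
  φ ∈-basis i = Σ (Fin (size i)) λ j → basis i j ≡ φ

  atom∈basis : ∀ p i → atom p ∈-basis i
  atom∈basis p zero    = p , refl
  atom∈basis p (suc i) = p ↑ˡ _ , cong (atoms-and-γ i) (splitAt-↑ˡ k p _)

  γ∈basis : ∀ i S → γ (basis i) S ∈-basis suc i
  γ∈basis i S = k ↑ʳ encode S ,
    trans (cong (atoms-and-γ i) (splitAt-↑ʳ k _ (encode S))) (cong (γ (basis i)) (decode-encode S))

module Bisimulation (lem : ExcludedMiddle (lsuc 0ℓ)) {k : ℕ} (M M' : InModel k) where
  open InModel M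
  open InModel M' using () renaming (W to W'; Sig to Sig'; V to V')
  open Hierarchy k
  open Characteristic using (χ; md-χ; γ)
  module At i = TwoModels lem M M' (basis i)

  Z : ℕ → W → W' → Set₁
  Z i = At.SameType i

  Z-agrees : ∀ i {w w' φ} → Z i w w' → φ ∈-basis i → true-at M w φ ⇔ true-at M' w' φ
  Z-agrees i z (j , refl) = At.SameType⇒agree i z j

  Z-atoms : ∀ i {w w'} → Z i w w' → ∀ p → V w p ≡ V' w' p
  Z-atoms i z p = ⇔→≡ (⇔-trans (⇔-sym (Support.true-at-atom M p))
                      (⇔-trans (Z-agrees i z (atom∈basis p i)) (Support.true-at-atom M' p)))

  Z-isBisim : ∀ n → IsBisim n M M' Z
  Z-isBisim n = (λ i w w' _ z → Z-atoms i z)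
              , λ i w w' _ z →
                  (λ s → At.zig i (λ S → from (Z-agrees (suc i) z (γ∈basis i S))))
                , (λ s' → At.zag i (λ S → to (Z-agrees (suc i) z (γ∈basis i S))))

  WorldEquiv⇒Z : ∀ {n w w'} → WorldEquiv n M M' w w' → Z n w w'
  WorldEquiv⇒Z {n} eqv = At.agree⇒SameType n λ j → eqv (basis n j) (md-basis n j)

  StateEquiv⇒EM-Z : ∀ {n s s'} → StateEquiv n M M' s s' → EM (Z n) s s'
  StateEquiv⇒EM-Z {n} eqv = At.EM-SameType n (At.Realizes-transfer n λ σ →
    eqv (¬f χ (basis n) σ) (md-¬f (χ (basis n) σ) (md-χ (basis n) (md-basis n) σ)))

theorem5p10 : ExcludedMiddle (lsuc 0ℓ) → ∀ (k n : ℕ) (M M' : InModel k) →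
    (∀ w w' → WorldEquiv n M M' w w' → WorldBisim n M M' w w')
    × (∀ s s' → StateEquiv n M M' s s' → StateBisim n M M' s s')
theorem5p10 lem k n M M' =
    (λ w w' eqv → Z , Z-isBisim n , WorldEquiv⇒Z eqv)
  , (λ s s' eqv → Z , Z-isBisim n , StateEquiv⇒EM-Z eqv)
  where open Bisimulation lem M M'
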